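{- Let $G$ be a connected graph. (1) If $\gamma_P(G) = \gamma(G)$, then $\gamma_P(G \Box P_n) = \gamma(G)$ for every path $P_n$ on $n \ge 1$ vertices. (2) If $\gamma_P(G) = Z(G)$ and $H$ is a connected graph with $\gamma(H)=1$, then $\gamma_P(G \Box H) = Z(G)$. (3) If $H$ is a connected graph with $v_s(G) = \gamma(G)$ and $v_s(H) = Z(H)$, then $\gamma_P(G \Box H) = \gamma(G)Z(H)$.
   Context: Graphs are finite and simple. $\gamma(G)$ is the domination number. A set $Z \subseteq V(G)$ is a zero forcing set if, starting with $Z$ observed and repeatedly letting any observed vertex with exactly one unobserved neighbor make that neighbor observed, eventually all vertices are observed; $Z(G)$ is the minimum size of such a set. A power dominating set is a set $S$ such that, after first observing $S$ and all neighbors of vertices of $S$ and then applying the same propagation rule repeatedly, all vertices are observed; $\gamma_P(G)$ is its minimum size. A leaf is a vertex of degree $1$; a strong support vertex is a vertex adjacent to at least two leaves; $v_s(G)$ is the number of strong support vertices. The Cartesian product $G \Box H$ has vertex set $V(G)\times V(H)$, with $(g_1,h_1)$ adjacent to $(g_2,h_2)$ iff either $g_1=g_2$ and $h_1h_2 \in E(H)$, or $h_1=h_2$ and $g_1g_2\in E(G)$. -}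

module Defs where

open import Data.Bool using (Bool; true; false; _∧_; _∨_; T; if_then_else_)
open import Data.Nat as ℕ using (ℕ; zero; suc; _≤_; _*_; _≡ᵇ_; _≤ᵇ_)
open import Data.Fin as Fin using (Fin; toℕ; remQuot; _≟_)
open import Data.Fin.Subset using (Subset; _∈_; ∣_∣)
open import Data.Product using (Σ; _×_; _,_; proj₁; proj₂; ∃)
open import Relation.Nullary using (¬_; yes; no)
open import Relation.Nullary.Decidable using (⌊_⌋)
open import Relation.Binary.PropositionalEquality using (_≡_; refl; sym; cong₂)

record Graph : Set where
  field
    n      : ℕ
    adj    : Fin n → Fin n → Bool
    adj-sym    : ∀ u v → adj u v ≡ adj v u
    adj-irrefl : ∀ v → adj v v ≡ false
open Graph public

Vertex : Graph → Set
Vertex G = Fin (n G)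

Adj : (G : Graph) → Vertex G → Vertex G → Set
Adj G u v = T (adj G u v)

data Reach (G : Graph) : Vertex G → Vertex G → Set where
  here : ∀ {u} → Reach G u u
  step : ∀ {u v w} → Adj G u v → Reach G v w → Reach G u w

Connected : Graph → Set
Connected G = (1 ≤ n G) × (∀ u v → Reach G u v)

Dominating : (G : Graph) → Subset (n G) → Set
Dominating G S = ∀ v → v ∈ S ⊎' (Σ (Vertex G) λ u → u ∈ S × Adj G u v)
  where
  open import Data.Sum renaming (_⊎_ to _⊎'_)

IsDomNum : Graph → ℕ → Set
IsDomNum G k =
  (Σ (Subset (n G)) λ S → Dominating G S × ∣ S ∣ ≡ k) ×
  (∀ S → Dominating G S → k ≤ ∣ S ∣)

-- Propagation (the zero forcing colour-change rule).  The derivable vertices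
-- form the least superset of I closed under the rule, i.e. the final
-- observed set of the process.

data Observed (G : Graph) (I : Vertex G → Set) : Vertex G → Set where
  init  : ∀ {v} → I v → Observed G I v
  force : ∀ {u v} → Observed G I u → Adj G u v →
          (∀ w → Adj G u w → ¬ (w ≡ v) → Observed G I w) →
          Observed G I v

ZeroForcing : (G : Graph) → Subset (n G) → Set
ZeroForcing G Z = ∀ v → Observed G (λ x → x ∈ Z) v

IsZFNum : Graph → ℕ → Set
IsZFNum G k =
  (Σ (Subset (n G)) λ S → ZeroForcing G S × ∣ S ∣ ≡ k) ×
  (∀ S → ZeroForcing G S → k ≤ ∣ S ∣)

ClosedNbhd : (G : Graph) → Subset (n G) → Vertex G → Set
ClosedNbhd G S v = v ∈ S ⊎' (Σ (Vertex G) λ u → u ∈ S × Adj G u v)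
  where
  open import Data.Sum renaming (_⊎_ to _⊎'_)

PowerDominating : (G : Graph) → Subset (n G) → Set
PowerDominating G S = ∀ v → Observed G (ClosedNbhd G S) v

IsPDNum : Graph → ℕ → Set
IsPDNum G k =
  (Σ (Subset (n G)) λ S → PowerDominating G S × ∣ S ∣ ≡ k) ×
  (∀ S → PowerDominating G S → k ≤ ∣ S ∣)

countF : ∀ {m} → (Fin m → Bool) → ℕ
countF {zero}  f = 0
countF {suc m} f = (if f Fin.zero then 1 else 0) ℕ.+ countF (λ i → f (Fin.suc i))

degree : (G : Graph) → Vertex G → ℕ
degree G v = countF (adj G v)

isLeaf : (G : Graph) → Vertex G → Bool
isLeaf G v = degree G v ≡ᵇ 1

leafNbrs : (G : Graph) → Vertex G → ℕ
leafNbrs G v = countF (λ u → adj G v u ∧ isLeaf G u)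

isStrongSupport : (G : Graph) → Vertex G → Bool
isStrongSupport G v = 2 ≤ᵇ leafNbrs G v

vs : Graph → ℕ
vs G = countF (isStrongSupport G)

eqF : ∀ {m} → Fin m → Fin m → Bool
eqF a b = ⌊ a ≟ b ⌋

private
  eqF-sym : ∀ {m} (a b : Fin m) → eqF a b ≡ eqF b a
  eqF-sym a b with a ≟ b | b ≟ a
  ... | yes _ | yes _ = refl
  ... | no _  | no _  = refl
  ... | yes p | no q  = ⊥-elim' (q (sym p))
    where open import Data.Empty renaming (⊥-elim to ⊥-elim')
  ... | no p  | yes q = ⊥-elim' (p (sym q))
    where open import Data.Empty renaming (⊥-elim to ⊥-elim')

  eqF-refl : ∀ {m} (a : Fin m) → eqF a a ≡ true
  eqF-refl a with a ≟ a
  ... | yes _ = refl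
  ... | no p  = ⊥-elim' (p refl)
    where open import Data.Empty renaming (⊥-elim to ⊥-elim')

  ∨-comm : ∀ a b → (a ∨ b) ≡ (b ∨ a)
  ∨-comm false false = refl
  ∨-comm false true  = refl
  ∨-comm true  false = refl
  ∨-comm true  true  = refl

pathAdj : ∀ {m} → Fin m → Fin m → Bool
pathAdj i j = (suc (toℕ i) ≡ᵇ toℕ j) ∨ (suc (toℕ j) ≡ᵇ toℕ i)

private
  ≡ᵇ-suc-self : ∀ k → (suc k ≡ᵇ k) ≡ false
  ≡ᵇ-suc-self zero    = refl
  ≡ᵇ-suc-self (suc k) = ≡ᵇ-suc-self k

Path : ℕ → Graph
Path m = record
  { n = m
  ; adj = pathAdj
  ; adj-sym = λ i j → ∨-comm (suc (toℕ i) ≡ᵇ toℕ j) (suc (toℕ j) ≡ᵇ toℕ i)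
  ; adj-irrefl = λ i → irr (toℕ i)
  }
  where
  irr : ∀ k → ((suc k ≡ᵇ k) ∨ (suc k ≡ᵇ k)) ≡ false
  irr k rewrite ≡ᵇ-suc-self k = refl

boxAdjP : (G H : Graph) → Vertex G × Vertex H → Vertex G × Vertex H → Bool
boxAdjP G H (g₁ , h₁) (g₂ , h₂) =
  (eqF g₁ g₂ ∧ adj H h₁ h₂) ∨ (eqF h₁ h₂ ∧ adj G g₁ g₂)

-- vertex (g , h) of G □ H is encoded as Fin.combine g h : Fin (n G * n H),
-- decoded by Fin.remQuot (a bijection)
boxAdj : (G H : Graph) → Fin (n G * n H) → Fin (n G * n H) → Bool
boxAdj G H x y = boxAdjP G H (remQuot {n G} (n H) x) (remQuot {n G} (n H) y)

_□_ : Graph → Graph → Graph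
G □ H = record
  { n = n G * n H
  ; adj = boxAdj G H
  ; adj-sym = λ x y → bsym (remQuot {n G} (n H) x) (remQuot {n G} (n H) y)
  ; adj-irrefl = λ x → birr (remQuot {n G} (n H) x)
  }
  where
  bsym : ∀ p q → boxAdjP G H p q ≡ boxAdjP G H q p
  bsym (g₁ , h₁) (g₂ , h₂)
    rewrite eqF-sym g₁ g₂ | eqF-sym h₁ h₂ | adj-sym H h₁ h₂ | adj-sym G g₁ g₂ = refl
  birr : ∀ p → boxAdjP G H p p ≡ false
  birr (g , h) rewrite eqF-refl g | eqF-refl h | adj-irrefl H h | adj-irrefl G g = refl

module Submission where

-- If D dominates G and Z is a zero forcing set of H, then D × Z power dominates G □ H: its
-- closed neighbourhood contains G × Z, and every forcing step of H can be replayed in each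
-- copy of H.  This gives the upper bounds, with Z the first vertex of the path in (1) and the
-- roles of the factors exchanged in (2).  For the lower bounds in (1) and (2), the projection
-- onto G of a power dominating set of G □ H power dominates G.  In (3), if s and t are strong
-- support vertices with leaves l₁, l₂ and m₁, m₂, a power dominating set must meet
-- {s, l₁, l₂} × {t, m₁, m₂}: otherwise no corner (lᵢ , mⱼ) is ever observed,
-- since every neighbour of a corner is adjacent to a second corner.  These sets are disjoint
-- for distinct pairs (s , t), so γ_P(G □ H) ≥ v_s(G) v_s(H).

open import Defs
open import Data.Nat using (ℕ; _≤_; _*_)
open import Data.Product using (_×_)
open import Relation.Binary.PropositionalEquality using (_≡_)

open import Data.Bool using (Bool; true; false; _∧_; _∨_; T; if_then_else_)
open import Data.Bool.Properties using (T-∧; T-∨; T-≡)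
open import Data.Empty using (⊥; ⊥-elim)
open import Data.Fin using (Fin; zero; suc; toℕ; fromℕ<; inject₁; combine; remQuot; _↑ˡ_; _↑ʳ_; _≟_)
open import Data.Fin.Properties using (toℕ-injective; toℕ-inject₁; remQuot-combine; combine-remQuot)
  renaming (suc-injective to Fin-suc-injective)
open import Data.Fin.Subset using (Subset; _∈_; _⊆_; ∣_∣; ⁅_⁆)
open import Data.Fin.Subset.Properties using (_∈?_; p⊆q⇒∣p∣≤∣q∣; x∈⁅x⁆; ∣⁅x⁆∣≡1)
open import Data.Nat using (zero; suc; _+_; z≤n; s≤s; _≡ᵇ_; _≤?_)
open import Data.Nat.Properties as ℕₚ
  using (≤-refl; ≤-trans; ≤-pred; ≤-reflexive; <⇒≱; ≰⇒>; +-assoc; +-mono-≤; m≤n+m; n≤1+n; *-identityʳ;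
         ≡ᵇ⇒≡; ≡⇒≡ᵇ; ≤ᵇ⇒≤)
open import Algebra.Properties.CommutativeSemigroup ℕₚ.+-commutativeSemigroup using (interchange)
open import Data.Product using (Σ; _,_; proj₁; proj₂)
open import Data.Sum using (_⊎_; inj₁; inj₂)
open import Data.Unit using (tt)
open import Data.Vec using (lookup; tabulate)
open import Data.Vec.Properties using (lookup∘tabulate; tabulate∘lookup; []=⇒lookup; lookup⇒[]=)
open import Function using (_∘_)
open import Function.Bundles using (Equivalence)
open import Relation.Nullary using (¬_; yes; no)
open import Relation.Nullary.Decidable using (toWitness; fromWitness)
open import Relation.Binary.PropositionalEquality
  using (refl; sym; trans; cong; cong₂; subst; _≢_; module ≡-Reasoning)

open Equivalence using (to; from)

indicator : Bool → ℕ
indicator b = if b then 1 else 0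

countF-≗ : ∀ {m} {f g : Fin m → Bool} → (∀ i → f i ≡ g i) → countF f ≡ countF g
countF-≗ {zero}  eq = refl
countF-≗ {suc m} eq = cong₂ _+_ (cong indicator (eq zero)) (countF-≗ (eq ∘ suc))

countF-false : ∀ m → countF {m} (λ _ → false) ≡ 0
countF-false zero    = refl
countF-false (suc m) = countF-false m

T⇒1≤countF : ∀ {m} (f : Fin m → Bool) i → T (f i) → 1 ≤ countF f
T⇒1≤countF f zero    fi with f zero
... | true = s≤s z≤n
T⇒1≤countF f (suc i) fi = ≤-trans (T⇒1≤countF (f ∘ suc) i fi) (m≤n+m _ _)

1≤countF⇒T : ∀ {m} (f : Fin m → Bool) → 1 ≤ countF f → Σ (Fin m) (T ∘ f)
1≤countF⇒T {suc m} f c with f zero in eq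
... | true  = zero , subst T (sym eq) tt
... | false = let i , fi = 1≤countF⇒T (f ∘ suc) c in suc i , fi

distinct⇒2≤countF : ∀ {m} (f : Fin m → Bool) {i j} → i ≢ j → T (f i) → T (f j) → 2 ≤ countF f
distinct⇒2≤countF f {zero}  {zero}  i≢j _ _ = ⊥-elim (i≢j refl)
distinct⇒2≤countF f {zero}  {suc j} _ fi fj with f zero
... | true = s≤s (T⇒1≤countF (f ∘ suc) j fj)
distinct⇒2≤countF f {suc i} {zero}  _ fi fj with f zero
... | true = s≤s (T⇒1≤countF (f ∘ suc) i fi)
distinct⇒2≤countF f {suc i} {suc j} i≢j fi fj =
  ≤-trans (distinct⇒2≤countF (f ∘ suc) (i≢j ∘ cong suc) fi fj) (m≤n+m _ _)

2≤countF⇒distinct : ∀ {m} (f : Fin m → Bool) → 2 ≤ countF f →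
                    Σ (Fin m) λ i → Σ (Fin m) λ j → i ≢ j × T (f i) × T (f j)
2≤countF⇒distinct {suc m} f c with f zero in eq
... | true  = let j , fj = 1≤countF⇒T (f ∘ suc) (≤-pred c) in zero , suc j , (λ ()) , subst T (sym eq) tt , fj
... | false = let i , j , i≢j , fi , fj = 2≤countF⇒distinct (f ∘ suc) c
              in suc i , suc j , i≢j ∘ Fin-suc-injective , fi , fj

countF≤1⇒unique : ∀ {m} (f : Fin m → Bool) → countF f ≤ 1 → ∀ {i j} → T (f i) → T (f j) → i ≡ j
countF≤1⇒unique f c {i} {j} fi fj with i ≟ j
... | yes i≡j = i≡j
... | no  i≢j = ⊥-elim (<⇒≱ (distinct⇒2≤countF f i≢j fi fj) c)

unique⇒countF≤1 : ∀ {m} (f : Fin m → Bool) → (∀ {i j} → T (f i) → T (f j) → i ≡ j) → countF f ≤ 1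
unique⇒countF≤1 f unique with 2 ≤? countF f
... | no  c = ≤-pred (≰⇒> c)
... | yes c = let i , j , i≢j , fi , fj = 2≤countF⇒distinct f c in ⊥-elim (i≢j (unique fi fj))

countF-∨ : ∀ {m} (f g : Fin m → Bool) → countF (λ i → f i ∨ g i) ≤ countF f + countF g
countF-∨ {zero}  f g = z≤n
countF-∨ {suc m} f g =
  ≤-trans (+-mono-≤ (indicator-∨ (f zero) (g zero)) (countF-∨ (f ∘ suc) (g ∘ suc)))
          (≤-reflexive (interchange (indicator (f zero)) (indicator (g zero))
                                    (countF (f ∘ suc)) (countF (g ∘ suc))))
  where
  indicator-∨ : ∀ a b → indicator (a ∨ b) ≤ indicator a + indicator b
  indicator-∨ true  b = s≤s z≤n
  indicator-∨ false b = ≤-refl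

countF-↑ : ∀ m n (f : Fin (m + n) → Bool) →
           countF f ≡ countF (λ i → f (i ↑ˡ n)) + countF (λ j → f (m ↑ʳ j))
countF-↑ zero    n f = refl
countF-↑ (suc m) n f = trans (cong (indicator (f zero) +_) (countF-↑ m n (f ∘ suc)))
                              (sym (+-assoc (indicator (f zero)) _ _))

countF-combine : ∀ m n (A : Fin m → Bool) (B : Fin n → Bool) (f : Fin (m * n) → Bool) →
                 (∀ i j → f (combine i j) ≡ A i ∧ B j) → countF f ≡ countF A * countF B
countF-combine zero    n A B f eq = refl
countF-combine (suc m) n A B f eq = begin
  countF f
    ≡⟨ countF-↑ n (m * n) f ⟩
  countF (λ j → f (combine {suc m} zero j)) + countF (λ y → f (n ↑ʳ y))
    ≡⟨ cong₂ _+_ (countF-≗ (eq zero)) (countF-combine m n (A ∘ suc) B (λ y → f (n ↑ʳ y)) (eq ∘ suc)) ⟩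
  countF (λ j → A zero ∧ B j) + countF (A ∘ suc) * countF B
    ≡⟨ row (A zero) ⟩
  countF A * countF B
    ∎
  where
  open ≡-Reasoning
  row : ∀ a → countF (λ j → a ∧ B j) + countF (A ∘ suc) * countF B
            ≡ (indicator a + countF (A ∘ suc)) * countF B
  row true  = refl
  row false = cong (_+ countF (A ∘ suc) * countF B) (countF-false n)

anyF : ∀ {m} → (Fin m → Bool) → Bool
anyF {zero}  f = false
anyF {suc m} f = f zero ∨ anyF (f ∘ suc)

T-anyF : ∀ {m} (f : Fin m → Bool) i → T (f i) → T (anyF f)
T-anyF f zero    fi = from T-∨ (inj₁ fi)
T-anyF f (suc i) fi = from (T-∨ {f zero}) (inj₂ (T-anyF (f ∘ suc) i fi))

countF-anyF≤ : ∀ {m k} (f : Fin m → Bool) (R : Fin m → Fin k → Bool) →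
               (∀ x {c c′} → T (R x c) → T (R x c′) → c ≡ c′) →
               countF (λ c → anyF (λ x → f x ∧ R x c)) ≤ countF f
countF-anyF≤ {zero}  {k} f R functional = ≤-reflexive (countF-false k)
countF-anyF≤ {suc m} {k} f R functional =
  ≤-trans (countF-∨ (λ c → f zero ∧ R zero c) (λ c → anyF (λ x → f (suc x) ∧ R (suc x) c)))
          (+-mono-≤ (reached-from-zero (f zero)) (countF-anyF≤ (f ∘ suc) (R ∘ suc) (functional ∘ suc)))
  where
  reached-from-zero : ∀ a → countF (λ c → a ∧ R zero c) ≤ indicator a
  reached-from-zero true  = unique⇒countF≤1 (R zero) (functional zero)
  reached-from-zero false = ≤-reflexive (countF-false k)

∣tabulate∣ : ∀ {m} (f : Fin m → Bool) → ∣ tabulate f ∣ ≡ countF f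
∣tabulate∣ {zero}  f = refl
∣tabulate∣ {suc m} f with f zero
... | true  = cong suc (∣tabulate∣ (f ∘ suc))
... | false = ∣tabulate∣ (f ∘ suc)

∣p∣≡countF : ∀ {m} (p : Subset m) → ∣ p ∣ ≡ countF (lookup p)
∣p∣≡countF p = trans (cong ∣_∣ (sym (tabulate∘lookup p))) (∣tabulate∣ (lookup p))

∈-tabulate⁺ : ∀ {m} {f : Fin m → Bool} {x} → T (f x) → x ∈ tabulate f
∈-tabulate⁺ {f = f} {x} fx = lookup⇒[]= x (tabulate f) (trans (lookup∘tabulate f x) (to T-≡ fx))

∈-tabulate⁻ : ∀ {m} {f : Fin m → Bool} {x} → x ∈ tabulate f → T (f x)
∈-tabulate⁻ {f = f} {x} x∈ = from T-≡ (trans (sym (lookup∘tabulate f x)) ([]=⇒lookup x∈))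

image : ∀ {m k} → (Fin m → Fin k → Bool) → Subset m → Subset k
image R p = tabulate (λ c → anyF (λ x → lookup p x ∧ R x c))

∈-image : ∀ {m k} (R : Fin m → Fin k → Bool) {p x c} → x ∈ p → T (R x c) → c ∈ image R p
∈-image R {p} {x} x∈p Rxc = ∈-tabulate⁺ (T-anyF _ x (from T-∧ (from T-≡ ([]=⇒lookup x∈p) , Rxc)))

∣image∣≤ : ∀ {m k} (R : Fin m → Fin k → Bool) (p : Subset m) →
           (∀ x {c c′} → T (R x c) → T (R x c′) → c ≡ c′) → ∣ image R p ∣ ≤ ∣ p ∣
∣image∣≤ R p functional = begin
  ∣ image R p ∣
    ≡⟨ ∣tabulate∣ (λ c → anyF (λ x → lookup p x ∧ R x c)) ⟩
  countF (λ c → anyF (λ x → lookup p x ∧ R x c))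
    ≤⟨ countF-anyF≤ (lookup p) R functional ⟩
  countF (lookup p)
    ≡⟨ sym (∣p∣≡countF p) ⟩
  ∣ p ∣
    ∎
  where open ℕₚ.≤-Reasoning

_⊠_ : ∀ {m n} → Subset m → Subset n → Subset (m * n)
_⊠_ {m} {n} p q = tabulate (λ x → lookup p (proj₁ (remQuot {m} n x)) ∧ lookup q (proj₂ (remQuot {m} n x)))

∣⊠∣ : ∀ {m n} (p : Subset m) (q : Subset n) → ∣ p ⊠ q ∣ ≡ ∣ p ∣ * ∣ q ∣
∣⊠∣ {m} {n} p q = begin
  ∣ p ⊠ q ∣                             ≡⟨ ∣tabulate∣ cell ⟩
  countF cell                           ≡⟨ countF-combine m n (lookup p) (lookup q) cell cell-combine ⟩
  countF (lookup p) * countF (lookup q) ≡⟨ sym (cong₂ _*_ (∣p∣≡countF p) (∣p∣≡countF q)) ⟩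
  ∣ p ∣ * ∣ q ∣                         ∎
  where
  open ≡-Reasoning
  cell : Fin (m * n) → Bool
  cell x = lookup p (proj₁ (remQuot {m} n x)) ∧ lookup q (proj₂ (remQuot {m} n x))
  cell-combine : ∀ i j → cell (combine i j) ≡ lookup p i ∧ lookup q j
  cell-combine i j = cong (λ (i′ , j′) → lookup p i′ ∧ lookup q j′) (remQuot-combine i j)

∈-⊠⁺ : ∀ {m n} {p : Subset m} {q : Subset n} {i j} → i ∈ p → j ∈ q → combine i j ∈ p ⊠ q
∈-⊠⁺ {p = p} {q} {i} {j} i∈p j∈q =
  ∈-tabulate⁺ (subst (λ (i′ , j′) → T (lookup p i′ ∧ lookup q j′)) (sym (remQuot-combine i j))
                     (from T-∧ (from T-≡ ([]=⇒lookup i∈p) , from T-≡ ([]=⇒lookup j∈q))))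

∈-⊠⁻ : ∀ {m n} {p : Subset m} {q : Subset n} {x} → x ∈ p ⊠ q →
       proj₁ (remQuot {m} n x) ∈ p × proj₂ (remQuot {m} n x) ∈ q
∈-⊠⁻ {m} {n} {p} {q} {x} x∈ =
  let i∈ , j∈ = to T-∧ (∈-tabulate⁻ x∈) in lookup⇒[]= _ p (to T-≡ i∈) , lookup⇒[]= _ q (to T-≡ j∈)

Adj-sym : ∀ (G : Graph) {u v} → Adj G u v → Adj G v u
Adj-sym G {u} {v} = subst T (adj-sym G u v)

leaf-neighbour-unique : ∀ (G : Graph) {l g g′} → T (isLeaf G l) → Adj G l g → Adj G l g′ → g ≡ g′
leaf-neighbour-unique G {l} leaf = countF≤1⇒unique (adj G l) (≤-reflexive (≡ᵇ⇒≡ (degree G l) 1 leaf))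

record StrongSupport (G : Graph) (s : Vertex G) : Set where
  field
    leaf            : Bool → Vertex G
    leaf-true≢false : leaf true ≢ leaf false
    leaf-isLeaf     : ∀ b → T (isLeaf G (leaf b))
    adj-leaf        : ∀ b → Adj G s (leaf b)

  Pendant : Vertex G → Set
  Pendant g = Σ Bool λ b → g ≡ leaf b

  Star : Vertex G → Set
  Star g = g ≡ s ⊎ Pendant g

  pendant-adj⇒support : ∀ {g g′} → Pendant g → Adj G g g′ → g′ ≡ s
  pendant-adj⇒support (b , refl) g~g′ =
    leaf-neighbour-unique G (leaf-isLeaf b) g~g′ (Adj-sym G (adj-leaf b))

  other-pendant : ∀ {g} → Pendant g → Σ (Vertex G) λ g′ → Pendant g′ × Adj G s g′ × g′ ≢ g
  other-pendant (true  , refl) = leaf false , (false , refl) , adj-leaf false , leaf-true≢false ∘ sym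
  other-pendant (false , refl) = leaf true  , (true  , refl) , adj-leaf true  , leaf-true≢false

  support-not-leaf : ¬ T (isLeaf G s)
  support-not-leaf s-leaf = leaf-true≢false (leaf-neighbour-unique G s-leaf (adj-leaf true) (adj-leaf false))

open StrongSupport using (Pendant; Star)

isStrongSupport⇒StrongSupport : ∀ G {s} → T (isStrongSupport G s) → StrongSupport G s
isStrongSupport⇒StrongSupport G {s} ss
  with l₁ , l₂ , l₁≢l₂ , l₁-leaf , l₂-leaf
         ← 2≤countF⇒distinct (λ u → adj G s u ∧ isLeaf G u) (≤ᵇ⇒≤ 2 _ ss)
  = record
  { leaf            = λ b → if b then l₁ else l₂
  ; leaf-true≢false = l₁≢l₂
  ; leaf-isLeaf     = λ { true → proj₂ (to T-∧ l₁-leaf) ; false → proj₂ (to T-∧ l₂-leaf) }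
  ; adj-leaf        = λ { true → proj₁ (to T-∧ l₁-leaf) ; false → proj₁ (to T-∧ l₂-leaf) }
  }

-- Requiring s to be a strong support vertex keeps it from being a leaf, so g lies in at most one star.
inLeafStar : (G : Graph) → Vertex G → Vertex G → Bool
inLeafStar G g s = isStrongSupport G s ∧ (eqF g s ∨ (adj G g s ∧ isLeaf G g))

inLeafStar-functional : ∀ G {g s s′} → T (inLeafStar G g s) → T (inLeafStar G g s′) → s ≡ s′
inLeafStar-functional G {g} {s} {s′} p p′
  with ss , q ← to T-∧ p | ss′ , q′ ← to (T-∧ {isStrongSupport G s′}) p′
  with to (T-∨ {eqF g s}) q | to (T-∨ {eqF g s′}) q′
... | inj₁ g≡s  | inj₁ g≡s′ = trans (sym (toWitness g≡s)) (toWitness g≡s′)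
... | inj₁ g≡s  | inj₂ leaf′ with refl ← toWitness g≡s =
  ⊥-elim (StrongSupport.support-not-leaf (isStrongSupport⇒StrongSupport G ss) (proj₂ (to T-∧ leaf′)))
... | inj₂ leaf | inj₁ g≡s′ with refl ← toWitness g≡s′ =
  ⊥-elim (StrongSupport.support-not-leaf (isStrongSupport⇒StrongSupport G ss′) (proj₂ (to T-∧ leaf)))
... | inj₂ leaf | inj₂ leaf′ =
  leaf-neighbour-unique G (proj₂ (to T-∧ leaf)) (proj₁ (to T-∧ leaf)) (proj₁ (to (T-∧ {adj G g s′}) leaf′))

Star⇒inLeafStar : ∀ G {s g} (σ : StrongSupport G s) → T (isStrongSupport G s) →
                  Star σ g → T (inLeafStar G g s)
Star⇒inLeafStar G {s} σ ss (inj₁ refl)  = from T-∧ (ss , from (T-∨ {eqF s s}) (inj₁ (fromWitness refl)))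
Star⇒inLeafStar G σ ss (inj₂ (b , refl)) =
  from T-∧ (ss , from T-∨ (inj₂ (from T-∧ (Adj-sym G (adj-leaf b) , leaf-isLeaf b))))
  where open StrongSupport σ

record IsCartesianProduct (K G H : Graph) : Set where
  field
    pair      : Vertex G → Vertex H → Vertex K
    fst       : Vertex K → Vertex G
    snd       : Vertex K → Vertex H
    fst-pair  : ∀ g h → fst (pair g h) ≡ g
    snd-pair  : ∀ g h → snd (pair g h) ≡ h
    pair-η    : ∀ x → pair (fst x) (snd x) ≡ x
    adjˡ      : ∀ {g g′} h → Adj G g g′ → Adj K (pair g h) (pair g′ h)
    adjʳ      : ∀ g {h h′} → Adj H h h′ → Adj K (pair g h) (pair g h′)
    adj-cases : ∀ {x y} → Adj K x y →
                (fst x ≡ fst y × Adj H (snd x) (snd y)) ⊎ (snd x ≡ snd y × Adj G (fst x) (fst y))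

  pair-≡ : ∀ {g h x} → g ≡ fst x → h ≡ snd x → pair g h ≡ x
  pair-≡ {x = x} refl refl = pair-η x

  adj-pair-cases : ∀ {g h x} → Adj K (pair g h) x →
                   (g ≡ fst x × Adj H h (snd x)) ⊎ (h ≡ snd x × Adj G g (fst x))
  adj-pair-cases {g} {h} gh~x with adj-cases gh~x
  ... | inj₁ (e , a) = inj₁ (trans (sym (fst-pair g h)) e , subst (λ h′ → Adj H h′ _) (snd-pair g h) a)
  ... | inj₂ (e , a) = inj₂ (trans (sym (snd-pair g h)) e , subst (λ g′ → Adj G g′ _) (fst-pair g h) a)

  adj-alongˡ : ∀ {x g} → Adj G (fst x) g → Adj K x (pair g (snd x))
  adj-alongˡ {x} {g} a = subst (λ y → Adj K y (pair g (snd x))) (pair-η x) (adjˡ (snd x) a)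

  adj-alongʳ : ∀ {x h} → Adj H (snd x) h → Adj K x (pair (fst x) h)
  adj-alongʳ {x} {h} a = subst (λ y → Adj K y (pair (fst x) h)) (pair-η x) (adjʳ (fst x) a)

swap : ∀ {K G H} → IsCartesianProduct K G H → IsCartesianProduct K H G
swap P = record
  { pair      = λ h g → pair g h
  ; fst       = snd
  ; snd       = fst
  ; fst-pair  = λ h g → snd-pair g h
  ; snd-pair  = λ h g → fst-pair g h
  ; pair-η    = pair-η
  ; adjˡ      = λ g → adjʳ g
  ; adjʳ      = λ h → adjˡ h
  ; adj-cases = Data.Sum.swap ∘ adj-cases
  }
  where open IsCartesianProduct P

□-isCartesianProduct : ∀ G H → IsCartesianProduct (G □ H) G H
□-isCartesianProduct G H = record
  { pair      = combine
  ; fst       = proj₁ ∘ rq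
  ; snd       = proj₂ ∘ rq
  ; fst-pair  = λ g h → cong proj₁ (remQuot-combine g h)
  ; snd-pair  = λ g h → cong proj₂ (remQuot-combine g h)
  ; pair-η    = combine-remQuot {n G} (n H)
  ; adjˡ      = λ {g} {g′} h g~g′ → adj-combine (from (T-∨ {eqF g g′ ∧ adj H h h})
                                      (inj₂ (from (T-∧ {eqF h h}) (fromWitness refl , g~g′))))
  ; adjʳ      = λ g {h} {h′} h~h′ → adj-combine (from (T-∨ {eqF g g ∧ adj H h h′})
                                      (inj₁ (from (T-∧ {eqF g g}) (fromWitness refl , h~h′))))
  ; adj-cases = cases
  }
  where
  rq : Vertex (G □ H) → Vertex G × Vertex H
  rq = remQuot {n G} (n H)

  adj-combine : ∀ {g h g′ h′} → T (boxAdjP G H (g , h) (g′ , h′)) → Adj (G □ H) (combine g h) (combine g′ h′)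
  adj-combine {g} {h} {g′} {h′} =
    subst T (sym (cong₂ (boxAdjP G H) (remQuot-combine g h) (remQuot-combine g′ h′)))

  cases : ∀ {x y} → Adj (G □ H) x y →
          (proj₁ (rq x) ≡ proj₁ (rq y) × Adj H (proj₂ (rq x)) (proj₂ (rq y))) ⊎
          (proj₂ (rq x) ≡ proj₂ (rq y) × Adj G (proj₁ (rq x)) (proj₁ (rq y)))
  cases {x} {y} x~y with to (T-∨ {eqF (proj₁ (rq x)) (proj₁ (rq y)) ∧ adj H (proj₂ (rq x)) (proj₂ (rq y))}) x~y
  ... | inj₁ p = let e , a = to (T-∧ {eqF (proj₁ (rq x)) (proj₁ (rq y))}) p in inj₁ (toWitness e , a)
  ... | inj₂ p = let e , a = to (T-∧ {eqF (proj₂ (rq x)) (proj₂ (rq y))}) p in inj₂ (toWitness e , a)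

module _ {K G H : Graph} (P : IsCartesianProduct K G H) where
  open IsCartesianProduct P

  -- A forcing step u → v of H is replayed in every copy of H: the neighbours of (g , u) other
  -- than (g , v) are (g , w), with w observed before the step, and (g′ , u), observed like (g , u).
  observed-lift : ∀ {I : Vertex K → Set} {J : Vertex H → Set} →
                  (∀ {h} → J h → ∀ g → Observed K I (pair g h)) →
                  ∀ {h} → Observed H J h → ∀ g → Observed K I (pair g h)
  observed-lift base (init j) g = base j g
  observed-lift {I} base (force {u} {v} o u~v others) g = force (observed-lift base o g) (adjʳ g u~v) others′
    where
    others′ : ∀ w → Adj K (pair g u) w → ¬ w ≡ pair g v → Observed K I w
    others′ w gu~w w≢gv with adj-pair-cases gu~w
    ... | inj₁ (g≡fw , u~sw) =
      subst (Observed K I) (pair-≡ g≡fw refl)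
        (observed-lift base (others (snd w) u~sw (λ sw≡v → w≢gv (sym (pair-≡ g≡fw (sym sw≡v))))) g)
    ... | inj₂ (u≡sw , _) =
      subst (Observed K I) (pair-≡ refl u≡sw) (observed-lift base o (fst w))

  dominating×zeroForcing⇒powerDominating : ∀ {D Z S} → Dominating G D → ZeroForcing H Z →
    (∀ {g h} → g ∈ D → h ∈ Z → pair g h ∈ S) → PowerDominating K S
  dominating×zeroForcing⇒powerDominating {D} {Z} {S} dom zf D×Z⊆S x =
    subst (Observed K (ClosedNbhd K S)) (pair-η x) (observed-lift fibre-observed (zf (snd x)) (fst x))
    where
    fibre-observed : ∀ {h} → h ∈ Z → ∀ g → Observed K (ClosedNbhd K S) (pair g h)
    fibre-observed {h} h∈Z g with dom g
    ... | inj₁ g∈D             = init (inj₁ (D×Z⊆S g∈D h∈Z))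
    ... | inj₂ (d , d∈D , d~g) = init (inj₂ (pair d h , D×Z⊆S d∈D h∈Z , adjˡ h d~g))

  -- A forcing step along G projects to a forcing step of G, a step along H to no step at all.
  powerDominating-fst : ∀ {S T} → (∀ {x} → x ∈ S → fst x ∈ T) → Vertex H →
                        PowerDominating K S → PowerDominating G T
  powerDominating-fst {S} {T} fst∈ h pd g =
    subst (Observed G (ClosedNbhd G T)) (fst-pair g h) (observed-fst (pd (pair g h)))
    where
    observed-fst : ∀ {x} → Observed K (ClosedNbhd K S) x → Observed G (ClosedNbhd G T) (fst x)
    observed-fst (init (inj₁ x∈S)) = init (inj₁ (fst∈ x∈S))
    observed-fst (init (inj₂ (u , u∈S , u~x))) with adj-cases u~x
    ... | inj₁ (fu≡fx , _)     = init (inj₁ (subst (_∈ T) fu≡fx (fst∈ u∈S)))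
    ... | inj₂ (_ , fu~fx)     = init (inj₂ (fst u , fst∈ u∈S , fu~fx))
    observed-fst (force {u} {x} o u~x others) with adj-cases u~x
    ... | inj₁ (fu≡fx , _)     = subst (Observed G (ClosedNbhd G T)) fu≡fx (observed-fst o)
    ... | inj₂ (_ , fu~fx)     = force (observed-fst o) fu~fx others′
      where
      others′ : ∀ g → Adj G (fst u) g → ¬ g ≡ fst x → Observed G (ClosedNbhd G T) g
      others′ g fu~g g≢fx = subst (Observed G (ClosedNbhd G T)) (fst-pair g (snd u))
        (observed-fst (others (pair g (snd u)) (adj-alongˡ fu~g)
                              (λ e → g≢fx (trans (sym (fst-pair g (snd u))) (cong fst e)))))

pendant-sibling : ∀ {K G H} (P : IsCartesianProduct K G H) {s t}
                  (σ : StrongSupport G s) (τ : StrongSupport H t) →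
                  let open IsCartesianProduct P in
                  ∀ {u x} → Pendant σ (fst x) → Pendant τ (snd x) → fst u ≡ fst x → Adj H (snd u) (snd x) →
                  Σ (Vertex K) λ w → Adj K u w × w ≢ x × Pendant σ (fst w) × Pendant τ (snd w)
pendant-sibling {K} {G} {H} P {s} {t} σ τ {u} {x} pσ pτ fu≡fx su~sx
  with h , pτ′ , t~h , h≢sx ← StrongSupport.other-pendant τ pτ
  = pair (fst u) h , u~w , w≢x ,
    subst (Pendant σ) (sym (trans (fst-pair (fst u) h) fu≡fx)) pσ ,
    subst (Pendant τ) (sym (snd-pair (fst u) h)) pτ′
  where
  open IsCartesianProduct P
  su≡t : snd u ≡ t
  su≡t = StrongSupport.pendant-adj⇒support τ pτ (Adj-sym H su~sx)
  u~w : Adj K u (pair (fst u) h)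
  u~w = adj-alongʳ (subst (λ h′ → Adj H h′ h) (sym su≡t) t~h)
  w≢x : pair (fst u) h ≢ x
  w≢x e = h≢sx (trans (sym (snd-pair (fst u) h)) (cong snd e))

module _ {K G H : Graph} (P : IsCartesianProduct K G H) {s t} (σ : StrongSupport G s) (τ : StrongSupport H t) where
  open IsCartesianProduct P

  ¬powerDominating-avoiding-stars : ∀ {S} → (∀ {x} → x ∈ S → Star σ (fst x) → Star τ (snd x) → ⊥) →
                                    ¬ PowerDominating K S
  ¬powerDominating-avoiding-stars {S} avoid pd =
    corner (pd (pair (leaf σ true) (leaf τ true))) (true , fst-pair _ _) (true , snd-pair _ _)
    where
    open StrongSupport using (leaf; pendant-adj⇒support)
    corner : ∀ {x} → Observed K (ClosedNbhd K S) x → Pendant σ (fst x) → Pendant τ (snd x) → ⊥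
    corner (init (inj₁ x∈S)) pσ pτ = avoid x∈S (inj₂ pσ) (inj₂ pτ)
    corner (init (inj₂ (u , u∈S , u~x))) pσ pτ with adj-cases u~x
    ... | inj₁ (fu≡fx , su~sx) =
      avoid u∈S (inj₂ (subst (Pendant σ) (sym fu≡fx) pσ)) (inj₁ (pendant-adj⇒support τ pτ (Adj-sym H su~sx)))
    ... | inj₂ (su≡sx , fu~fx) =
      avoid u∈S (inj₁ (pendant-adj⇒support σ pσ (Adj-sym G fu~fx))) (inj₂ (subst (Pendant τ) (sym su≡sx) pτ))
    corner (force o u~x others) pσ pτ with adj-cases u~x
    ... | inj₁ (fu≡fx , su~sx)
      with w , u~w , w≢x , pσ′ , pτ′ ← pendant-sibling P σ τ pσ pτ fu≡fx su~sx
      = corner (others w u~w w≢x) pσ′ pτ′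
    ... | inj₂ (su≡sx , fu~fx)
      with w , u~w , w≢x , pτ′ , pσ′ ← pendant-sibling (swap P) τ σ pτ pσ su≡sx fu~fx
      = corner (others w u~w w≢x) pσ′ pτ′

path-zeroForcing : ∀ m → ZeroForcing (Path (suc m)) ⁅ zero ⁆
path-zeroForcing m j = observed (toℕ j) j ≤-refl
  where
  Obs : Fin (suc m) → Set
  Obs = Observed (Path (suc m)) (_∈ ⁅ zero ⁆)
  observed : ∀ k (j : Fin (suc m)) → toℕ j ≤ k → Obs j
  observed k       zero    _         = init (x∈⁅x⁆ zero)
  observed (suc k) (suc j) (s≤s j≤k) =
    force (observed k (inject₁ j) (≤-trans (≤-reflexive (toℕ-inject₁ j)) j≤k)) j~j+1 others
    where
    j~j+1 : Adj (Path (suc m)) (inject₁ j) (suc j)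
    j~j+1 = from T-∨ (inj₁ (≡⇒≡ᵇ _ _ (cong suc (toℕ-inject₁ j))))
    others : ∀ w → Adj (Path (suc m)) (inject₁ j) w → ¬ w ≡ suc j → Obs w
    others w j~w w≢j+1 with to (T-∨ {suc (toℕ (inject₁ j)) ≡ᵇ toℕ w}) j~w
    ... | inj₁ e = ⊥-elim (w≢j+1 (toℕ-injective (trans (sym (≡ᵇ⇒≡ _ _ e)) (cong suc (toℕ-inject₁ j)))))
    ... | inj₂ e = observed k w (begin
      toℕ w               ≤⟨ n≤1+n (toℕ w) ⟩
      suc (toℕ w)         ≡⟨ ≡ᵇ⇒≡ _ _ e ⟩
      toℕ (inject₁ j)     ≡⟨ toℕ-inject₁ j ⟩
      toℕ j               ≤⟨ j≤k ⟩
      k                   ∎)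
      where open ℕₚ.≤-Reasoning

module _ (G H : Graph) where
  open IsCartesianProduct (□-isCartesianProduct G H)

  IsPDNum⇒≤-□ : ∀ {k S} → IsPDNum G k → Vertex H → PowerDominating (G □ H) S → k ≤ ∣ S ∣
  IsPDNum⇒≤-□ {k} {S} (_ , minimal) h pd =
    ≤-trans (minimal (image fst≡ S) (powerDominating-fst (□-isCartesianProduct G H) fst∈ h pd))
            (∣image∣≤ fst≡ S (λ x p q → trans (sym (toWitness p)) (toWitness q)))
    where
    fst≡ : Vertex (G □ H) → Vertex G → Bool
    fst≡ x g = eqF (fst x) g
    fst∈ : ∀ {x} → x ∈ S → fst x ∈ image fst≡ S
    fst∈ x∈S = ∈-image fst≡ x∈S (fromWitness refl)

  inLeafStars : Vertex (G □ H) → Vertex (G □ H) → Bool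
  inLeafStars x c = inLeafStar G (fst x) (fst c) ∧ inLeafStar H (snd x) (snd c)

  inLeafStars-functional : ∀ x {c c′} → T (inLeafStars x c) → T (inLeafStars x c′) → c ≡ c′
  inLeafStars-functional x {c} {c′} p q =
    let pG , pH = to T-∧ p ; qG , qH = to T-∧ q
    in trans (sym (pair-≡ refl refl)) (pair-≡ (inLeafStar-functional G pG qG) (inLeafStar-functional H pH qH))

  vs*vs≤∣powerDominating∣ : ∀ {S} → PowerDominating (G □ H) S → vs G * vs H ≤ ∣ S ∣
  vs*vs≤∣powerDominating∣ {S} pd = begin
    vs G * vs H               ≡⟨ sym (cong₂ _*_ (∣tabulate∣ (isStrongSupport G))
                                                (∣tabulate∣ (isStrongSupport H))) ⟩
    ∣ supportsG ∣ * ∣ supportsH ∣ ≡⟨ sym (∣⊠∣ supportsG supportsH) ⟩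
    ∣ supportsG ⊠ supportsH ∣   ≤⟨ p⊆q⇒∣p∣≤∣q∣ supports⊆image ⟩
    ∣ image inLeafStars S ∣    ≤⟨ ∣image∣≤ inLeafStars S inLeafStars-functional ⟩
    ∣ S ∣                     ∎
    where
    open ℕₚ.≤-Reasoning
    supportsG : Subset (n G)
    supportsG = tabulate (isStrongSupport G)
    supportsH : Subset (n H)
    supportsH = tabulate (isStrongSupport H)
    supports⊆image : supportsG ⊠ supportsH ⊆ image inLeafStars S
    supports⊆image {c} c∈ with c ∈? image inLeafStars S
    ... | yes c∈image = c∈image
    ... | no  c∉image =
      ⊥-elim (¬powerDominating-avoiding-stars (□-isCartesianProduct G H) σ τ avoid pd)
      where
      ssG : T (isStrongSupport G (fst c))
      ssG = ∈-tabulate⁻ (proj₁ (∈-⊠⁻ {p = supportsG} {supportsH} c∈))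
      ssH : T (isStrongSupport H (snd c))
      ssH = ∈-tabulate⁻ (proj₂ (∈-⊠⁻ {p = supportsG} {supportsH} c∈))
      σ = isStrongSupport⇒StrongSupport G ssG
      τ = isStrongSupport⇒StrongSupport H ssH
      avoid : ∀ {x} → x ∈ S → Star σ (fst x) → Star τ (snd x) → ⊥
      avoid x∈S sσ sτ =
        c∉image (∈-image inLeafStars x∈S (from T-∧ (Star⇒inLeafStar G σ ssG sσ , Star⇒inLeafStar H τ ssH sτ)))

IsPDNum-□-Path : ∀ G {k} → IsDomNum G k → IsPDNum G k → ∀ m → IsPDNum (G □ Path (suc m)) k
IsPDNum-□-Path G {k} ((D , dom , ∣D∣≡k) , _) γP m =
  (D ⊠ ⁅ zero ⁆ , pd , size) , λ S → IsPDNum⇒≤-□ G (Path (suc m)) γP zero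
  where
  pd : PowerDominating (G □ Path (suc m)) (D ⊠ ⁅ zero ⁆)
  pd = dominating×zeroForcing⇒powerDominating (□-isCartesianProduct G (Path (suc m)))
         dom (path-zeroForcing m) ∈-⊠⁺
  size : ∣ D ⊠ ⁅ zero ⁆ ∣ ≡ k
  size = trans (∣⊠∣ D ⁅ zero ⁆) (trans (cong₂ _*_ ∣D∣≡k (∣⁅x⁆∣≡1 {suc m} zero)) (*-identityʳ k))

IsPDNum-□-universalVertex : ∀ G H {k} → IsPDNum G k → IsZFNum G k → Vertex H → IsDomNum H 1 →
                            IsPDNum (G □ H) k
IsPDNum-□-universalVertex G H {k} γP ((Z , zf , ∣Z∣≡k) , _) h ((D , dom , ∣D∣≡1) , _) =
  (Z ⊠ D , pd , size) , λ S → IsPDNum⇒≤-□ G H γP h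
  where
  pd : PowerDominating (G □ H) (Z ⊠ D)
  pd = dominating×zeroForcing⇒powerDominating (swap (□-isCartesianProduct G H))
         dom zf (λ h∈D g∈Z → ∈-⊠⁺ g∈Z h∈D)
  size : ∣ Z ⊠ D ∣ ≡ k
  size = trans (∣⊠∣ Z D) (trans (cong₂ _*_ ∣Z∣≡k ∣D∣≡1) (*-identityʳ k))

IsPDNum-□-strongSupports : ∀ G H {a b} → IsDomNum G a → vs G ≡ a → IsZFNum H b → vs H ≡ b →
                           IsPDNum (G □ H) (a * b)
IsPDNum-□-strongSupports G H ((D , dom , ∣D∣≡a) , _) vsG≡a ((Z , zf , ∣Z∣≡b) , _) vsH≡b =
  (D ⊠ Z , pd , trans (∣⊠∣ D Z) (cong₂ _*_ ∣D∣≡a ∣Z∣≡b)) ,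
  λ S → subst (_≤ ∣ S ∣) (cong₂ _*_ vsG≡a vsH≡b) ∘ vs*vs≤∣powerDominating∣ G H
  where
  pd : PowerDominating (G □ H) (D ⊠ Z)
  pd = dominating×zeroForcing⇒powerDominating (□-isCartesianProduct G H) dom zf ∈-⊠⁺

-- Connectivity is needed only to have a vertex of H in (2).
corollary3p9 : (G : Graph) → Connected G →
    (∀ k → IsDomNum G k → IsPDNum G k →
      ∀ m → 1 ≤ m → IsPDNum (G □ Path m) k)
    ×
    (∀ k → IsPDNum G k → IsZFNum G k →
      ∀ (H : Graph) → Connected H → IsDomNum H 1 → IsPDNum (G □ H) k)
    ×
    (∀ (H : Graph) → Connected H → ∀ a b →
      IsDomNum G a → vs G ≡ a → IsZFNum H b → vs H ≡ b →
      IsPDNum (G □ H) (a * b))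
corollary3p9 G _ =
  (λ { k γ γP (suc m) _ → IsPDNum-□-Path G γ γP m }) ,
  (λ k γP Zk H (1≤n , _) γH → IsPDNum-□-universalVertex G H γP Zk (fromℕ< 1≤n) γH) ,
  (λ H _ a b → IsPDNum-□-strongSupports G H)
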